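{- Define, for $(a,b,c,d,e)\in\mathbb{Q}_+^5$, $$T(a,b,c,d,e)=\frac{ab(c^2+d^2+e^2)+(a^2+b^2+cd)(c+d)e}{abcd}-9,$$ $$\mathcal{C}_0=\frac{a^2+b^2+cd}{ab},\quad \mathcal{C}_1=\frac{c^2d+a^2c+b^2d+abe}{bcd},\quad \mathcal{C}_2=\frac{cd^2+a^2c+b^2d+abe}{acd},$$ $\varphi(a,b,c,d,e)=(\mathcal{C}_0,\mathcal{C}_1,\mathcal{C}_2)\in\mathbb{Q}_+^3$, and $\widetilde{T}(X,Y,Z)=XYZ-X^2-Y^2-Z^2-7$. Then for every $P\in\mathbb{Q}_+^5$, $$T(P)=\widetilde{T}(\varphi(P)).$$
   Context: $\mathbb{Q}_+$ denotes the positive rationals. -}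

module Defs where

open import Data.Product using (Σ; _,_; proj₁)
open import Data.Rational using (ℚ; Positive; _+_; _*_; _-_; _÷_; NonZero)
open import Data.Rational.Properties using (pos⇒nonZero; pos*pos⇒pos)

ℚ₊ : Set
ℚ₊ = Σ ℚ Positive

_*₊_ : ℚ₊ → ℚ₊ → ℚ₊
(p , pp) *₊ (q , qp) = p * q , pos*pos⇒pos p {{pp}} q {{qp}}

_÷₊_ : ℚ → ℚ₊ → ℚ
p ÷₊ (q , qp) = _÷_ p q {{pos⇒nonZero q {{qp}}}}

infixl 7 _*₊_ _÷₊_

T : ℚ₊ → ℚ₊ → ℚ₊ → ℚ₊ → ℚ₊ → ℚ
T A@(a , _) B@(b , _) C@(c , _) D@(d , _) (e , _) =
  ((a * b * (c * c + d * d + e * e) + (a * a + b * b + c * d) * (c + d) * e)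
     ÷₊ (A *₊ B *₊ C *₊ D)) - 9ℚ
  where open import Data.Rational using () renaming (_/_ to _//_)
        open import Data.Integer using (+_)
        9ℚ : ℚ
        9ℚ = + 9 // 1

C₀ : ℚ₊ → ℚ₊ → ℚ₊ → ℚ₊ → ℚ₊ → ℚ
C₀ A@(a , _) B@(b , _) (c , _) (d , _) _ = (a * a + b * b + c * d) ÷₊ (A *₊ B)

C₁ : ℚ₊ → ℚ₊ → ℚ₊ → ℚ₊ → ℚ₊ → ℚ
C₁ (a , _) B@(b , _) C@(c , _) D@(d , _) (e , _) =
  (c * c * d + a * a * c + b * b * d + a * b * e) ÷₊ (B *₊ C *₊ D)

C₂ : ℚ₊ → ℚ₊ → ℚ₊ → ℚ₊ → ℚ₊ → ℚ
C₂ A@(a , _) (b , _) C@(c , _) D@(d , _) (e , _) =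
  (c * d * d + a * a * c + b * b * d + a * b * e) ÷₊ (A *₊ C *₊ D)

T̃ : ℚ → ℚ → ℚ → ℚ
T̃ X Y Z = X * Y * Z - X * X - Y * Y - Z * Z - 7ℚ
  where open import Data.Rational using () renaming (_/_ to _//_)
        open import Data.Integer using (+_)
        7ℚ : ℚ
        7ℚ = + 7 // 1

{-# OPTIONS --safe #-}
-- Both sides become polynomials after multiplication by (abcd)², which is
-- exactly the product ab · bcd · acd of the denominators of C₀, C₁, C₂.
-- The two cleared polynomials agree identically, and (abcd)² is positive,
-- so it can be cancelled.
module Submission where

open import Defs
open import Relation.Binary.PropositionalEquality
  using (_≡_; refl; sym; cong; module ≡-Reasoning)
open import Data.Product using (_,_; proj₁)
open import Data.Rational using (ℚ; _+_; _*_; _-_; _÷_; NonZero; 1/_; 1ℚ)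
  renaming (_/_ to _//_)
open import Data.Integer using (+_)
open import Data.Rational.Properties
  using (pos⇒nonZero; *-assoc; *-inverseˡ; *-identityʳ;
         *-cancelʳ-≤-pos; ≤-antisym; ≤-reflexive)
open import Data.Rational.Solver using (module +-*-Solver)
open +-*-Solver

÷-*-cancel : ∀ x q .{{_ : NonZero q}} → (x ÷ q) * q ≡ x
÷-*-cancel x q = begin
  x * 1/ q * q    ≡⟨ *-assoc x (1/ q) q ⟩
  x * (1/ q * q)  ≡⟨ cong (x *_) (*-inverseˡ q) ⟩
  x * 1ℚ          ≡⟨ *-identityʳ x ⟩
  x               ∎
  where open ≡-Reasoning

÷₊-*-cancel : ∀ x (q : ℚ₊) → (x ÷₊ q) * proj₁ q ≡ x
÷₊-*-cancel x (q , q>0) = ÷-*-cancel x q {{pos⇒nonZero q {{q>0}}}}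

*₊-cancelʳ-≡ : ∀ {x y} (q : ℚ₊) → x * proj₁ q ≡ y * proj₁ q → x ≡ y
*₊-cancelʳ-≡ (q , q>0) xq≡yq = ≤-antisym
  (*-cancelʳ-≤-pos q {{q>0}} (≤-reflexive xq≡yq))
  (*-cancelʳ-≤-pos q {{q>0}} (≤-reflexive (sym xq≡yq)))

nine seven : ℚ
nine = + 9 // 1
seven = + 7 // 1

module ClearingDenominators (a b c d e : ℚ) where

  abcd K N n₀ n₁ n₂ : ℚ
  abcd = a * b * c * d
  K = abcd * abcd
  N = a * b * (c * c + d * d + e * e) + (a * a + b * b + c * d) * (c + d) * e
  n₀ = a * a + b * b + c * d
  n₁ = c * c * d + a * a * c + b * b * d + a * b * e
  n₂ = c * d * d + a * a * c + b * b * d + a * b * e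

  -- cleared x y z = T̃ (x / ab) (y / bcd) (z / acd) * (abcd)²
  cleared : ℚ → ℚ → ℚ → ℚ
  cleared x y z = x * y * z - x * x * (c * d) * (c * d)
                - y * y * (a * a) - z * z * (b * b) - seven * K

  N*abcd-9K≡cleared : N * abcd - nine * K ≡ cleared n₀ n₁ n₂
  N*abcd-9K≡cleared = solve 5 (λ a b c d e →
      let abcd = a :* b :* c :* d
          n₀ = a :* a :+ b :* b :+ c :* d
          n₁ = c :* c :* d :+ a :* a :* c :+ b :* b :* d :+ a :* b :* e
          n₂ = c :* d :* d :+ a :* a :* c :+ b :* b :* d :+ a :* b :* e
      in (a :* b :* (c :* c :+ d :* d :+ e :* e) :+ n₀ :* (c :+ d) :* e) :* abcd
           :- con nine :* (abcd :* abcd)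
         := n₀ :* n₁ :* n₂ :- n₀ :* n₀ :* (c :* d) :* (c :* d)
           :- n₁ :* n₁ :* (a :* a) :- n₂ :* n₂ :* (b :* b)
           :- con seven :* (abcd :* abcd))
    refl a b c d e

  clear-T : ∀ U → U * abcd ≡ N → (U - nine) * K ≡ N * abcd - nine * K
  clear-T U U*abcd≡N = begin
    (U - nine) * K                  ≡⟨ solve 5 (λ U a b c d →
                                         let abcd = a :* b :* c :* d in
                                         (U :- con nine) :* (abcd :* abcd)
                                           := U :* abcd :* abcd :- con nine :* (abcd :* abcd))
                                       refl U a b c d ⟩
    U * abcd * abcd - nine * K      ≡⟨ cong (λ t → t * abcd - nine * K) U*abcd≡N ⟩
    N * abcd - nine * K             ∎
    where open ≡-Reasoning

  clear-T̃ : ∀ X Y Z → X * (a * b) ≡ n₀ → Y * (b * c * d) ≡ n₁ → Z * (a * c * d) ≡ n₂ →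
            T̃ X Y Z * K ≡ cleared n₀ n₁ n₂
  clear-T̃ X Y Z Xab≡n₀ Ybcd≡n₁ Zacd≡n₂ = begin
    T̃ X Y Z * K
      ≡⟨ solve 7 (λ X Y Z a b c d →
           let x = X :* (a :* b)
               y = Y :* (b :* c :* d)
               z = Z :* (a :* c :* d)
               abcd = a :* b :* c :* d
           in (X :* Y :* Z :- X :* X :- Y :* Y :- Z :* Z :- con seven) :* (abcd :* abcd)
              := x :* y :* z :- x :* x :* (c :* d) :* (c :* d)
                :- y :* y :* (a :* a) :- z :* z :* (b :* b) :- con seven :* (abcd :* abcd))
         refl X Y Z a b c d ⟩
    cleared (X * (a * b)) (Y * (b * c * d)) (Z * (a * c * d))
      ≡⟨ cong (λ x → cleared x _ _) Xab≡n₀ ⟩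
    cleared n₀ (Y * (b * c * d)) (Z * (a * c * d))
      ≡⟨ cong (λ y → cleared n₀ y _) Ybcd≡n₁ ⟩
    cleared n₀ n₁ (Z * (a * c * d))
      ≡⟨ cong (cleared n₀ n₁) Zacd≡n₂ ⟩
    cleared n₀ n₁ n₂ ∎
    where open ≡-Reasoning

lemma3p1 : (a b c d e : ℚ₊) →
    T a b c d e ≡ T̃ (C₀ a b c d e) (C₁ a b c d e) (C₂ a b c d e)
lemma3p1 A@(a , _) B@(b , _) C@(c , _) D@(d , _) E@(e , _) =
  *₊-cancelʳ-≡ (abcd₊ *₊ abcd₊) (begin
    T A B C D E * K                  ≡⟨ clear-T (N ÷₊ abcd₊) (÷₊-*-cancel N abcd₊) ⟩
    N * abcd - nine * K              ≡⟨ N*abcd-9K≡cleared ⟩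
    cleared n₀ n₁ n₂                 ≡⟨ sym (clear-T̃ (C₀ A B C D E) (C₁ A B C D E) (C₂ A B C D E)
                                           (÷₊-*-cancel n₀ (A *₊ B))
                                           (÷₊-*-cancel n₁ (B *₊ C *₊ D))
                                           (÷₊-*-cancel n₂ (A *₊ C *₊ D))) ⟩
    T̃ (C₀ A B C D E) (C₁ A B C D E) (C₂ A B C D E) * K ∎)
  where open ClearingDenominators a b c d e
        open ≡-Reasoning
        abcd₊ : ℚ₊
        abcd₊ = A *₊ B *₊ C *₊ D
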